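{- Let $\mathcal{L}$ be a set of lines of $\mathrm{PG}(n,q)$ satisfying (Pt), (Pl), (Sd) and (To), let $M$ be a $4$-dimensional subspace of $\mathrm{PG}(n,q)$, and let $P$ be a $(q+1)$-$M$-point. Then the plane $\pi_P$ contains at most $q+2$ points that are $(q+1)$-$M$-points.
   Context: $q$ is a prime power. Conditions: (Pt) every point of $\mathrm{PG}(n,q)$ lies on either $0$ or $q+1$ lines of $\mathcal{L}$; (Pl) every plane contains $0$, $1$ or $q+1$ lines of $\mathcal{L}$; (Sd) every solid ($3$-dimensional subspace) contains $0$, $1$, $q+1$ or $2q+1$ lines of $\mathcal{L}$; (To) $|\mathcal{L}|\le q^5+q^4+q^3+q^2+q+1$. For a subspace $X$, $\mathcal{L}_X$ is the set of lines of $\mathcal{L}$ contained in $X$; for a point $P$, $\mathcal{L}_P$ is the set of lines of $\mathcal{L}$ through $P$. A point $P$ is a $(q+1)$-$M$-point if $|\mathcal{L}_M\cap\mathcal{L}_P|=q+1$. For a point $P$ on lines of $\mathcal{L}$, $\pi_P:=\langle\mathcal{L}_P\rangle$ (the $q+1$ lines of $\mathcal{L}$ through $P$ are coplanar, so $\pi_P$ is a plane). -}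

module Defs where

open import Level using (Level; _⊔_) renaming (suc to lsuc)
open import Data.Nat using (ℕ; zero; suc)
open import Data.Fin using (Fin; zero; suc)
open import Data.Product using (Σ; ∃; _×_; _,_)
open import Data.List using (List; []; _∷_)
open import Data.List.Membership.Propositional using (_∈_)
open import Data.List.Relation.Unary.AllPairs using (AllPairs)
open import Relation.Nullary using (¬_)
open import Relation.Binary.PropositionalEquality using (_≡_)
open import Algebra.Bundles using (CommutativeRing)

record Field (c ℓ : Level) : Set (lsuc (c ⊔ ℓ)) where
  field
    commutativeRing : CommutativeRing c ℓ
  open CommutativeRing commutativeRing public
  field
    1≉0 : ¬ (1# ≈ 0#)
    inverse : ∀ x → ¬ (x ≈ 0#) → ∃ λ y → (x * y) ≈ 1#

record HasOrder {c ℓ : Level} (F : Field c ℓ) (q : ℕ) : Set (c ⊔ ℓ) where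
  open Field F using (Carrier; _≈_; _+_; _*_; 0#)
  field
    enum : Fin q → Carrier
    enum-injective : ∀ i j → enum i ≈ enum j → i ≡ j
    enum-surjective : ∀ x → ∃ λ i → enum i ≈ x

data CountIs {a p : Level} {A : Set a} (P : A → Set p) : List A → ℕ → Set (a ⊔ p) where
  count-[] : CountIs P [] 0
  count-yes : ∀ {x xs k} → P x → CountIs P xs k → CountIs P (x ∷ xs) (suc k)
  count-no : ∀ {x xs k} → ¬ P x → CountIs P xs k → CountIs P (x ∷ xs) k

-- The projective space PG(n,F): subspaces are spans of vectors in F^(n+1).

module PG {c ℓ : Level} (F : Field c ℓ) (n : ℕ) where
  open Field F using (Carrier; _≈_; _+_; _*_; 0#)

  Vect : Set c
  Vect = Fin (suc n) → Carrier

  _≋_ : Vect → Vect → Set ℓ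
  u ≋ v = ∀ i → u i ≈ v i

  𝟎 : Vect
  𝟎 _ = 0#

  _·_ : Carrier → Vect → Vect
  (a · v) i = a * v i

  _⊕_ : Vect → Vect → Vect
  (u ⊕ v) i = u i + v i

  lincomb : ∀ {k} → (Fin k → Carrier) → (Fin k → Vect) → Vect
  lincomb {zero} c B = 𝟎
  lincomb {suc k} c B = (c zero · B zero) ⊕ lincomb (λ i → c (suc i)) (λ i → B (suc i))

  InSpan : ∀ {k} → (Fin k → Vect) → Vect → Set (c ⊔ ℓ)
  InSpan {k} B v = ∃ λ (cs : Fin k → Carrier) → lincomb cs B ≋ v

  LinIndep : ∀ {k} → (Fin k → Vect) → Set (c ⊔ ℓ)
  LinIndep {k} B = ∀ (cs : Fin k → Carrier) → lincomb cs B ≋ 𝟎 → ∀ i → cs i ≈ 0#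

  -- a subspace of projective dimension d, given by a basis of d+1 vectors
  record Sub (d : ℕ) : Set (c ⊔ ℓ) where
    constructor sub
    field
      basis : Fin (suc d) → Vect
      independent : LinIndep basis
  open Sub public

  Point Line Plane Solid : Set (c ⊔ ℓ)
  Point = Sub 0
  Line = Sub 1
  Plane = Sub 2
  Solid = Sub 3

  _∈ᵥ_ : ∀ {d} → Vect → Sub d → Set (c ⊔ ℓ)
  v ∈ᵥ X = InSpan (basis X) v

  _⊆_ : ∀ {d e} → Sub d → Sub e → Set (c ⊔ ℓ)
  X ⊆ Y = ∀ i → basis X i ∈ᵥ Y

  _≐_ : ∀ {d e} → Sub d → Sub e → Set (c ⊔ ℓ)
  X ≐ Y = (X ⊆ Y) × (Y ⊆ X)

  LineSet : List Line → Set (c ⊔ ℓ)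
  LineSet L = AllPairs (λ l m → ¬ (l ≐ m)) L

  PointSet : List Point → Set (c ⊔ ℓ)
  PointSet Ps = AllPairs (λ P Q → ¬ (P ≐ Q)) Ps

  NumLinesIn : ∀ {d} → List Line → Sub d → ℕ → Set (c ⊔ ℓ)
  NumLinesIn L X k = CountIs (λ l → l ⊆ X) L k

  NumLinesThrough : List Line → Point → ℕ → Set (c ⊔ ℓ)
  NumLinesThrough L P k = CountIs (λ l → P ⊆ l) L k

  IsMPoint : ∀ {d} → ℕ → List Line → Sub d → Point → Set (c ⊔ ℓ)
  IsMPoint q L M P = CountIs (λ l → (l ⊆ M) × (P ⊆ l)) L (suc q)

  OnLineThrough : List Line → Point → Vect → Set (c ⊔ ℓ)
  OnLineThrough L P w = ∃ λ l → (l ∈ L) × (P ⊆ l) × (w ∈ᵥ l)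

  data Gen (S : Vect → Set (c ⊔ ℓ)) : Vect → Set (c ⊔ ℓ) where
    gen-𝟎 : Gen S 𝟎
    gen-step : ∀ a w {u} → S w → Gen S u → Gen S ((a · w) ⊕ u)

  InSpanOf : (Vect → Set (c ⊔ ℓ)) → Vect → Set (c ⊔ ℓ)
  InSpanOf S v = ∃ λ u → Gen S u × (u ≋ v)

  InPiP : List Line → Point → Point → Set (c ⊔ ℓ)
  InPiP L P Q = InSpanOf (OnLineThrough L P) (basis Q zero)

module Submission where

-- Counting the lines in the three planes spanned by three lines through a point would give a solid
-- with more than 2q + 1 lines, so the q + 1 lines through P span a plane π, which lies in M.  Every
-- point Q ≠ P of π lies on one of them, and if Q is a (q+1)-M-point it also lies on a line leaving π;
-- hence all lines through Q lie in one of the q + 1 solids of M containing π.  Two such points Q and R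
-- in the same solid would make the pencils of P, Q and R, of q + 1 lines each and pairwise sharing at
-- most one line, put at least 3q lines into that solid.  So the points of π other than P inject into
-- the q + 1 solids.

open import Defs
open import Level using (Level; _⊔_)
import Data.Nat as Nat
open Nat using (ℕ; zero; suc; _≤_; z≤n; s≤s)
import Data.Nat.Properties as ℕP
open import Data.Nat.Tactic.RingSolver using (solve-∀)
open import Data.Fin using (Fin; zero; suc; punchIn; punchOut)
import Data.Fin.Properties as FinP
open import Data.Product using (Σ; ∃; ∃₂; _×_; _,_; proj₁; proj₂)
open import Data.Sum using (_⊎_; inj₁; inj₂; [_,_])
open import Data.Empty using (⊥; ⊥-elim)
open import Data.List using (List; length; lookup)
open import Data.List.Relation.Unary.All using (All)
open import Data.List.Relation.Unary.AllPairs using (AllPairs; _∷_)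
import Data.List.Relation.Unary.All as All
open import Data.List.Membership.Propositional.Properties using (∈-lookup)
import Data.List.Relation.Unary.Any as Any
import Data.List.Relation.Unary.Any.Properties as AnyP
open import Relation.Nullary using (¬_; Dec; yes; no; ¬?)
open import Relation.Nullary.Decidable using (_×-dec_; _⊎-dec_; decidable-stable)
open import Relation.Unary using (Pred; Decidable)
open import Relation.Unary.Properties using (_∩?_)
open import Function using (_∘_; case_of_)
open import Data.Vec.Functional using () renaming (_∷_ to _◁_)
open import Relation.Binary.PropositionalEquality as ≡ using (_≡_; _≢_)

module Counting where

  open Nat using (_+_; _*_)
  open import Relation.Unary using (_⊆_)
  open import Relation.Unary.Properties using (_∪?_)
  open import Algebra.Properties.CommutativeMonoid.Sum ℕP.+-0-commutativeMonoid using (sum; sum-cong-≗; ∑-distrib-+)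

  indicator : ∀ {p} {A : Set p} → Dec A → ℕ
  indicator (yes _) = 1
  indicator (no _) = 0

  count : ∀ {m p} {P : Pred (Fin m) p} → Decidable P → ℕ
  count P? = sum (indicator ∘ P?)

  sum-mono : ∀ {m} {f g : Fin m → ℕ} → (∀ i → f i ≤ g i) → sum f ≤ sum g
  sum-mono {zero} f≤g = z≤n
  sum-mono {suc m} f≤g = ℕP.+-mono-≤ (f≤g zero) (sum-mono (f≤g ∘ suc))

  indicator-mono : ∀ {p r} {A : Set p} {B : Set r} (a : Dec A) (b : Dec B) → (A → B) → indicator a ≤ indicator b
  indicator-mono (yes _) (yes _) _ = s≤s z≤n
  indicator-mono (yes x) (no ¬y) f = ⊥-elim (¬y (f x))
  indicator-mono (no _) _ _ = z≤n

  count-mono : ∀ {m p r} {P : Pred (Fin m) p} {Q : Pred (Fin m) r} (P? : Decidable P) (Q? : Decidable Q) →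
               P ⊆ Q → count P? ≤ count Q?
  count-mono P? Q? P⊆Q = sum-mono λ i → indicator-mono (P? i) (Q? i) P⊆Q

  count-mono-< : ∀ {m p r} {P : Pred (Fin m) p} {Q : Pred (Fin m) r} (P? : Decidable P) (Q? : Decidable Q) →
                 P ⊆ Q → ∀ {i} → Q i → ¬ P i → suc (count P?) ≤ count Q?
  count-mono-< P? Q? P⊆Q {zero} Q₀ ¬P₀ with P? zero | Q? zero
  ... | yes P₀ | _ = ⊥-elim (¬P₀ P₀)
  ... | no _ | no ¬Q₀ = ⊥-elim (¬Q₀ Q₀)
  ... | no _ | yes _ = s≤s (count-mono (P? ∘ suc) (Q? ∘ suc) P⊆Q)
  count-mono-< P? Q? P⊆Q {suc i} Qi ¬Pi = begin
    suc (indicator (P? zero) + count (P? ∘ suc)) ≡⟨ ℕP.+-suc _ _ ⟨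
    indicator (P? zero) + suc (count (P? ∘ suc)) ≤⟨ ℕP.+-mono-≤ (indicator-mono (P? zero) (Q? zero) P⊆Q)
                                                               (count-mono-< (P? ∘ suc) (Q? ∘ suc) P⊆Q Qi ¬Pi) ⟩
    indicator (Q? zero) + count (Q? ∘ suc)       ∎
    where open ℕP.≤-Reasoning

  count-cong : ∀ {m p r} {P : Pred (Fin m) p} {Q : Pred (Fin m) r} (P? : Decidable P) (Q? : Decidable Q) →
               P ⊆ Q → Q ⊆ P → count P? ≡ count Q?
  count-cong P? Q? P⊆Q Q⊆P = ℕP.≤-antisym (count-mono P? Q? P⊆Q) (count-mono Q? P? Q⊆P)

  module _ {m p r} {P : Pred (Fin m) p} {Q : Pred (Fin m) r} (P? : Decidable P) (Q? : Decidable Q) where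

    count-inclusion-exclusion : count P? + count Q? ≡ count (P? ∪? Q?) + count (P? ∩? Q?)
    count-inclusion-exclusion = begin
      count P? + count Q?                                             ≡⟨ ∑-distrib-+ (indicator ∘ P?) (indicator ∘ Q?) ⟨
      sum (λ i → indicator (P? i) + indicator (Q? i))                 ≡⟨ sum-cong-≗ (λ i → pointwise (P? i) (Q? i)) ⟩
      sum (λ i → indicator ((P? ∪? Q?) i) + indicator ((P? ∩? Q?) i)) ≡⟨ ∑-distrib-+ (indicator ∘ (P? ∪? Q?)) (indicator ∘ (P? ∩? Q?)) ⟩
      count (P? ∪? Q?) + count (P? ∩? Q?)                             ∎
      where
      open ≡.≡-Reasoning
      pointwise : ∀ {A : Set p} {B : Set r} (a : Dec A) (b : Dec B) →
                  indicator a + indicator b ≡ indicator (a ⊎-dec b) + indicator (a ×-dec b)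
      pointwise (yes _) (yes _) = ≡.refl
      pointwise (yes _) (no _) = ≡.refl
      pointwise (no _) (yes _) = ≡.refl
      pointwise (no _) (no _) = ≡.refl

    count-∪-≤ : count (P? ∪? Q?) ≤ count P? + count Q?
    count-∪-≤ = ℕP.≤-trans (ℕP.m≤m+n _ _) (ℕP.≤-reflexive (≡.sym count-inclusion-exclusion))

    count-two-within : ∀ {s} {S : Pred (Fin m) s} (S? : Decidable S) → P ⊆ S → Q ⊆ S →
                       count P? + count Q? ≤ count S? + count (P? ∩? Q?)
    count-two-within S? P⊆S Q⊆S = begin
      count P? + count Q?                 ≡⟨ count-inclusion-exclusion ⟩
      count (P? ∪? Q?) + count (P? ∩? Q?) ≤⟨ ℕP.+-monoˡ-≤ _ (count-mono (P? ∪? Q?) S? [ P⊆S , Q⊆S ]) ⟩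
      count S? + count (P? ∩? Q?)         ∎
      where open ℕP.≤-Reasoning

  count-three-within : ∀ {m p r t s} {A : Pred (Fin m) p} {B : Pred (Fin m) r} {C : Pred (Fin m) t} {S : Pred (Fin m) s}
    (A? : Decidable A) (B? : Decidable B) (C? : Decidable C) (S? : Decidable S) → A ⊆ S → B ⊆ S → C ⊆ S →
    count A? + count B? + count C? ≤ count S? + count (A? ∩? B?) + count (A? ∩? C?) + count (B? ∩? C?)
  count-three-within A? B? C? S? A⊆S B⊆S C⊆S = begin
    count A? + count B? + count C?                        ≡⟨ ≡.cong (_+ count C?) (count-inclusion-exclusion A? B?) ⟩
    count (A? ∪? B?) + count (A? ∩? B?) + count C?        ≡⟨ swap (count (A? ∪? B?)) _ _ ⟩
    count (A? ∪? B?) + count C? + count (A? ∩? B?)        ≤⟨ ℕP.+-monoˡ-≤ _ (count-two-within (A? ∪? B?) C? S? [ A⊆S , B⊆S ] C⊆S) ⟩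
    count S? + count ((A? ∪? B?) ∩? C?) + count (A? ∩? B?) ≤⟨ ℕP.+-monoˡ-≤ _ (ℕP.+-monoʳ-≤ (count S?) ∪∩≤) ⟩
    count S? + (count (A? ∩? C?) + count (B? ∩? C?)) + count (A? ∩? B?) ≡⟨ reorder (count S?) _ _ _ ⟩
    count S? + count (A? ∩? B?) + count (A? ∩? C?) + count (B? ∩? C?) ∎
    where
    open ℕP.≤-Reasoning
    ∪∩≤ : count ((A? ∪? B?) ∩? C?) ≤ count (A? ∩? C?) + count (B? ∩? C?)
    ∪∩≤ = ℕP.≤-trans (count-mono ((A? ∪? B?) ∩? C?) ((A? ∩? C?) ∪? (B? ∩? C?)) λ { (a∪b , c) → Data.Sum.map (_, c) (_, c) a∪b })
                     (count-∪-≤ (A? ∩? C?) (B? ∩? C?))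
    swap : ∀ a b c → a + b + c ≡ a + c + b
    swap = solve-∀
    reorder : ∀ s ac bc ab → s + (ac + bc) + ab ≡ s + ab + ac + bc
    reorder = solve-∀

  count-≤-injection : ∀ {m p k} {P : Pred (Fin m) p} (P? : Decidable P) (f : ∀ i → P i → Fin k) →
                      (∀ i j Pi Pj → f i Pi ≡ f j Pj → i ≡ j) → count P? ≤ k
  count-≤-injection {zero} P? f f-inj = z≤n
  count-≤-injection {suc m} P? f f-inj with P? zero
  ... | no _ = count-≤-injection (P? ∘ suc) (f ∘ suc) λ i j Pi Pj e → FinP.suc-injective (f-inj _ _ Pi Pj e)
  count-≤-injection {suc m} {k = zero} P? f f-inj | yes P₀ = ⊥-elim (FinP.¬Fin0 (f zero P₀))
  count-≤-injection {suc m} {k = suc k} P? f f-inj | yes P₀ =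
    s≤s (count-≤-injection (P? ∘ suc) (λ i Pi → punchOut (f₀≢ i Pi)) λ i j Pi Pj e →
      FinP.suc-injective (f-inj _ _ Pi Pj (FinP.punchOut-injective (f₀≢ i Pi) (f₀≢ j Pj) e)))
    where
    f₀≢ : ∀ i Pi → f zero P₀ ≢ f (suc i) Pi
    f₀≢ i Pi e = FinP.0≢1+n (f-inj zero (suc i) P₀ Pi e)

  count-≤1 : ∀ {m p} {P : Pred (Fin m) p} (P? : Decidable P) → (∀ {i j} → P i → P j → i ≡ j) → count P? ≤ 1
  count-≤1 P? unique = count-≤-injection P? (λ _ _ → zero) λ _ _ Pi Pj _ → unique Pi Pj

  1≤count : ∀ {m p} {P : Pred (Fin m) p} (P? : Decidable P) {i} → P i → 1 ≤ count P?
  1≤count P? {zero} Pi with P? zero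
  ... | yes _ = s≤s z≤n
  ... | no ¬P₀ = ⊥-elim (¬P₀ Pi)
  1≤count P? {suc i} Pi = ℕP.≤-trans (1≤count (P? ∘ suc) Pi) (ℕP.m≤n+m _ (indicator (P? zero)))

  2≤count : ∀ {m p} {P : Pred (Fin m) p} (P? : Decidable P) {i j} → i ≢ j → P i → P j → 2 ≤ count P?
  2≤count P? {zero} {zero} i≢j _ _ = ⊥-elim (i≢j ≡.refl)
  2≤count P? {zero} {suc j} _ Pi Pj with P? zero
  ... | yes _ = s≤s (1≤count (P? ∘ suc) Pj)
  ... | no ¬P₀ = ⊥-elim (¬P₀ Pi)
  2≤count P? {suc i} {zero} _ Pi Pj with P? zero
  ... | yes _ = s≤s (1≤count (P? ∘ suc) Pi)
  ... | no ¬P₀ = ⊥-elim (¬P₀ Pj)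
  2≤count P? {suc i} {suc j} i≢j Pi Pj =
    ℕP.≤-trans (2≤count (P? ∘ suc) (i≢j ∘ ≡.cong suc) Pi Pj) (ℕP.m≤n+m _ (indicator (P? zero)))

  1≤count⇒∃ : ∀ {m p} {P : Pred (Fin m) p} (P? : Decidable P) → 1 ≤ count P? → ∃ P
  1≤count⇒∃ {zero} P? ()
  1≤count⇒∃ {suc m} P? 1≤# with P? zero
  ... | yes P₀ = zero , P₀
  ... | no _ = let (i , Pi) = 1≤count⇒∃ (P? ∘ suc) 1≤# in suc i , Pi

  2≤count⇒∃₂ : ∀ {m p} {P : Pred (Fin m) p} (P? : Decidable P) → 2 ≤ count P? → ∃₂ λ i j → i ≢ j × P i × P j
  2≤count⇒∃₂ {zero} P? ()
  2≤count⇒∃₂ {suc m} P? 2≤# with P? zero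
  ... | yes P₀ = let (j , Pj) = 1≤count⇒∃ (P? ∘ suc) (ℕP.+-cancelˡ-≤ 1 1 _ 2≤#) in zero , suc j , FinP.0≢1+n , P₀ , Pj
  ... | no _ = let (i , j , i≢j , Pi , Pj) = 2≤count⇒∃₂ (P? ∘ suc) 2≤# in suc i , suc j , i≢j ∘ FinP.suc-injective , Pi , Pj

  CountIs⇒count : ∀ {a p k} {A : Set a} {P : Pred A p} (P? : Decidable P) {xs : List A} →
                  CountIs P xs k → k ≡ count (P? ∘ lookup xs)
  CountIs⇒count P? count-[] = ≡.refl
  CountIs⇒count P? (count-yes {x} Px c) with P? x
  ... | yes _ = ≡.cong suc (CountIs⇒count P? c)
  ... | no ¬Px = ⊥-elim (¬Px Px)
  CountIs⇒count P? (count-no {x} ¬Px c) with P? x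
  ... | yes Px = ⊥-elim (¬Px Px)
  ... | no _ = CountIs⇒count P? c

  module _ {m p r s} {q : ℕ} {A : Pred (Fin m) p} {B : Pred (Fin m) r} {S : Pred (Fin m) s}
           (A? : Decidable A) (B? : Decidable B) (S? : Decidable S) where

    no-two-large-within : 1 ≤ q → A ⊆ S → B ⊆ S →
      count A? ≡ q + 1 → count B? ≡ q + 1 → count S? ≤ q + 1 → count (A? ∩? B?) ≤ 1 → ⊥
    no-two-large-within 1≤q A⊆S B⊆S #A #B #S #AB = ℕP.<⇒≱ (ℕP.+-monoˡ-≤ 1 1≤q) (ℕP.+-cancelˡ-≤ (q + 1) _ _ (begin
      q + 1 + (q + 1)             ≡⟨ ≡.cong₂ _+_ #A #B ⟨
      count A? + count B?         ≤⟨ count-two-within A? B? S? A⊆S B⊆S ⟩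
      count S? + count (A? ∩? B?) ≤⟨ ℕP.+-mono-≤ #S #AB ⟩
      q + 1 + 1                   ∎))
      where open ℕP.≤-Reasoning

    no-three-large-within : ∀ {t} {C : Pred (Fin m) t} (C? : Decidable C) → 2 ≤ q → A ⊆ S → B ⊆ S → C ⊆ S →
      count A? ≡ q + 1 → count B? ≡ q + 1 → count C? ≡ q + 1 → count S? ≤ 2 * q + 1 →
      count (A? ∩? B?) ≤ 1 → count (A? ∩? C?) ≤ 1 → count (B? ∩? C?) ≤ 1 → ⊥
    no-three-large-within C? 2≤q A⊆S B⊆S C⊆S #A #B #C #S #AB #AC #BC = ℕP.<⇒≱ 2≤q (ℕP.+-cancelʳ-≤ _ q 1 (begin
      q + (2 * q + 3)                          ≡⟨ three-sets q ⟩
      q + 1 + (q + 1) + (q + 1)                ≡⟨ ≡.cong₂ _+_ (≡.cong₂ _+_ #A #B) #C ⟨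
      count A? + count B? + count C?           ≤⟨ count-three-within A? B? C? S? A⊆S B⊆S C⊆S ⟩
      count S? + count (A? ∩? B?) + count (A? ∩? C?) + count (B? ∩? C?)
                                               ≤⟨ ℕP.+-mono-≤ (ℕP.+-mono-≤ (ℕP.+-mono-≤ #S #AB) #AC) #BC ⟩
      2 * q + 1 + 1 + 1 + 1                    ≡⟨ bound q ⟩
      1 + (2 * q + 3)                          ∎))
      where
      open ℕP.≤-Reasoning
      three-sets : ∀ q → q + (2 * q + 3) ≡ q + 1 + (q + 1) + (q + 1)
      three-sets = solve-∀
      bound : ∀ q → 2 * q + 1 + 1 + 1 + 1 ≡ 1 + (2 * q + 3)
      bound = solve-∀

AllPairs-lookup : ∀ {a r} {A : Set a} {R : A → A → Set r} {xs : List A} → AllPairs R xs →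
  ∀ {i j} → i ≢ j → R (lookup xs i) (lookup xs j) ⊎ R (lookup xs j) (lookup xs i)
AllPairs-lookup (_ ∷ _) {zero} {zero} i≢j = ⊥-elim (i≢j ≡.refl)
AllPairs-lookup (Rx ∷ _) {zero} {suc j} _ = inj₁ (All.lookup Rx (∈-lookup j))
AllPairs-lookup (Rx ∷ _) {suc i} {zero} _ = inj₂ (All.lookup Rx (∈-lookup i))
AllPairs-lookup (_ ∷ Rxs) {suc i} {suc j} i≢j = AllPairs-lookup Rxs (i≢j ∘ ≡.cong suc)

module LinearAlgebra {c ℓ} (F : Field c ℓ) {q : ℕ} (F-order : HasOrder F q) (n : ℕ) where

  open Field F hiding (zero) renaming (refl to ≈-refl)
  open HasOrder F-order
  open PG F n
  open import Algebra.Bundles using (Ring)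
  open import Algebra.Properties.RingWithoutOne (Ring.ringWithoutOne ring) using (-‿distribˡ-*; -‿distribʳ-*)
  open import Algebra.Properties.Group +-group using (inverseʳ-unique; ⁻¹-involutive)
  open import Algebra.Properties.Semiring.Sum semiring using (sum)
  open import Relation.Binary.Reasoning.Setoid setoid
  open import Algebra.Properties.CommutativeSemigroup +-commutativeSemigroup
    using () renaming (interchange to +-interchange; x∙yz≈y∙xz to +-rearrange)
  open import Data.Vec.Functional.Properties using (insertAt-lookup; insertAt-punchIn)
  open import Data.Vec.Functional using (insertAt)

  _≈?_ : ∀ x y → Dec (x ≈ y)
  x ≈? y with enum-surjective x | enum-surjective y
  ... | i , eᵢ | j , eⱼ with i FinP.≟ j
  ... | yes ≡.refl = yes (trans (sym eᵢ) eⱼ)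
  ... | no i≢j = no λ x≈y → i≢j (enum-injective i j (trans eᵢ (trans x≈y (sym eⱼ))))

  2≤q : 2 ≤ q
  2≤q = distinct⇒2≤ (proj₁ (enum-surjective 0#)) (proj₁ (enum-surjective 1#)) λ e →
    1≉0 (trans (sym (proj₂ (enum-surjective 1#))) (trans (reflexive (≡.cong enum (≡.sym e))) (proj₂ (enum-surjective 0#))))
    where
    distinct⇒2≤ : ∀ {m} (i j : Fin m) → i ≢ j → 2 ≤ m
    distinct⇒2≤ {suc zero} zero zero i≢j = ⊥-elim (i≢j ≡.refl)
    distinct⇒2≤ {suc (suc m)} _ _ _ = s≤s (s≤s z≤n)

  inv : ∀ x → ¬ x ≈ 0# → Carrier
  inv x x≉0 = proj₁ (inverse x x≉0)

  inv-l : ∀ x (x≉0 : ¬ x ≈ 0#) → inv x x≉0 * x ≈ 1#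
  inv-l x x≉0 = trans (*-comm _ _) (proj₂ (inverse x x≉0))

  +-cancel-neg : ∀ x y → x + (y + - x) ≈ y
  +-cancel-neg x y = trans (+-rearrange x y (- x)) (trans (+-congˡ (-‿inverseʳ x)) (+-identityʳ y))

  neg*neg : ∀ x y → - x * - y ≈ x * y
  neg*neg x y = trans (sym (-‿distribˡ-* x (- y))) (trans (-‿cong (sym (-‿distribʳ-* x y))) (⁻¹-involutive _))

  drop-zero-term : ∀ {a b r v} → a ≈ 0# → a * b + r ≈ v → r ≈ v
  drop-zero-term {a} {b} {r} a≈0 e = trans (sym (trans (+-congʳ (trans (*-congʳ a≈0) (zeroˡ b))) (+-identityˡ r))) e

  Fam : ℕ → Set c
  Fam k = Fin k → Vect

  ≋-refl : ∀ {u} → u ≋ u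
  ≋-refl _ = ≈-refl

  ≋-trans : ∀ {u v w} → u ≋ v → v ≋ w → u ≋ w
  ≋-trans u≋v v≋w i = trans (u≋v i) (v≋w i)

  lincomb-cong : ∀ {k} {cs ds : Fin k → Carrier} {B C : Fam k} →
                 (∀ i → cs i ≈ ds i) → (∀ i → B i ≋ C i) → lincomb cs B ≋ lincomb ds C
  lincomb-cong {zero} _ _ _ = ≈-refl
  lincomb-cong {suc k} cs≈ds B≋C x = +-cong (*-cong (cs≈ds zero) (B≋C zero x)) (lincomb-cong (cs≈ds ∘ suc) (B≋C ∘ suc) x)

  lincomb-zero : ∀ {k} {cs : Fin k → Carrier} (B : Fam k) → (∀ i → cs i ≈ 0#) → lincomb cs B ≋ 𝟎
  lincomb-zero {zero} B _ _ = ≈-refl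
  lincomb-zero {suc k} B cs≈0 x =
    trans (+-cong (trans (*-congʳ (cs≈0 zero)) (zeroˡ _)) (lincomb-zero (B ∘ suc) (cs≈0 ∘ suc) x)) (+-identityʳ 0#)

  lincomb-+ : ∀ {k} (cs ds : Fin k → Carrier) (B : Fam k) → lincomb (λ i → cs i + ds i) B ≋ (lincomb cs B ⊕ lincomb ds B)
  lincomb-+ {zero} cs ds B x = sym (+-identityʳ 0#)
  lincomb-+ {suc k} cs ds B x = trans (+-congˡ (lincomb-+ (cs ∘ suc) (ds ∘ suc) (B ∘ suc) x))
    (trans (+-congʳ (distribʳ _ _ _)) (+-interchange _ _ _ _))

  lincomb-* : ∀ {k} a (cs : Fin k → Carrier) (B : Fam k) → lincomb (λ i → a * cs i) B ≋ (a · lincomb cs B)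
  lincomb-* {zero} a cs B x = sym (zeroʳ a)
  lincomb-* {suc k} a cs B x = trans (+-congˡ (lincomb-* a (cs ∘ suc) (B ∘ suc) x))
    (trans (+-congʳ (*-assoc _ _ _)) (sym (distribˡ _ _ _)))

  lincomb-⊕ : ∀ {k} (cs : Fin k → Carrier) (B C : Fam k) → lincomb cs (λ i → B i ⊕ C i) ≋ (lincomb cs B ⊕ lincomb cs C)
  lincomb-⊕ {zero} cs B C x = sym (+-identityʳ 0#)
  lincomb-⊕ {suc k} cs B C x = trans (+-congˡ (lincomb-⊕ (cs ∘ suc) (B ∘ suc) (C ∘ suc) x))
    (trans (+-congʳ (distribˡ _ _ _)) (+-interchange _ _ _ _))

  lincomb-multiples : ∀ {k} (cs μ : Fin k → Carrier) u → lincomb cs (λ i → μ i · u) ≋ (sum (λ i → cs i * μ i) · u)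
  lincomb-multiples {zero} cs μ u x = sym (zeroˡ _)
  lincomb-multiples {suc k} cs μ u x = trans (+-congˡ (lincomb-multiples (cs ∘ suc) (μ ∘ suc) u x))
    (trans (+-congʳ (sym (*-assoc _ _ _))) (sym (distribʳ _ _ _)))

  lincomb-punchIn : ∀ {k} (cs : Fin (suc k) → Carrier) (B : Fam (suc k)) j →
    lincomb cs B ≋ ((cs j · B j) ⊕ lincomb (cs ∘ punchIn j) (B ∘ punchIn j))
  lincomb-punchIn cs B zero x = ≈-refl
  lincomb-punchIn {suc k} cs B (suc j) x = trans (+-congˡ (lincomb-punchIn (cs ∘ suc) (B ∘ suc) j x)) (+-rearrange _ _ _)

  -- Records rather than the Σ-types of InSpan, so that the families can be inferred by unification.
  infix 4 _∈⟨_⟩ _⊑_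

  record _∈⟨_⟩ {k} (v : Vect) (B : Fam k) : Set (c ⊔ ℓ) where
    constructor span
    field combination : InSpan B v
  open _∈⟨_⟩ public

  record _⊑_ {k m} (A : Fam k) (B : Fam m) : Set (c ⊔ ℓ) where
    constructor span⊑
    field at : ∀ i → A i ∈⟨ B ⟩
  open _⊑_ public

  coefficients : ∀ {k m} {A : Fam k} {B : Fam m} → A ⊑ B → Fin k → Fin m → Carrier
  coefficients A⊑B i = proj₁ (combination (at A⊑B i))

  ∈-resp-≋ : ∀ {k} {B : Fam k} {u v} → u ≋ v → u ∈⟨ B ⟩ → v ∈⟨ B ⟩
  ∈-resp-≋ u≋v (span (cs , e)) = span (cs , ≋-trans e u≋v)

  𝟎-∈ : ∀ {k} (B : Fam k) → 𝟎 ∈⟨ B ⟩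
  𝟎-∈ B = span ((λ _ → 0#) , lincomb-zero B (λ _ → ≈-refl))

  ⊕-∈ : ∀ {k} {B : Fam k} {u v} → u ∈⟨ B ⟩ → v ∈⟨ B ⟩ → (u ⊕ v) ∈⟨ B ⟩
  ⊕-∈ {B = B} (span (cs , e)) (span (ds , f)) = span ((λ i → cs i + ds i) , ≋-trans (lincomb-+ cs ds B) (λ x → +-cong (e x) (f x)))

  ·-∈ : ∀ {k} {B : Fam k} a {u} → u ∈⟨ B ⟩ → (a · u) ∈⟨ B ⟩
  ·-∈ {B = B} a (span (cs , e)) = span ((λ i → a * cs i) , ≋-trans (lincomb-* a cs B) (λ x → *-congˡ (e x)))

  generator-∈ : ∀ {k} (B : Fam k) i → B i ∈⟨ B ⟩
  generator-∈ {suc k} B zero =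
    span ((1# ◁ λ _ → 0#) , λ x → trans (+-cong (*-identityˡ _) (lincomb-zero (B ∘ suc) (λ _ → ≈-refl) x)) (+-identityʳ _))
  generator-∈ {suc k} B (suc i) with generator-∈ (B ∘ suc) i
  ... | span (cs , e) = span ((0# ◁ cs) , λ x → trans (+-cong (zeroˡ _) (e x)) (+-identityˡ _))

  ∈-◁ : ∀ {k} {B : Fam k} u {v} → v ∈⟨ B ⟩ → v ∈⟨ u ◁ B ⟩
  ∈-◁ u (span (cs , e)) = span ((0# ◁ cs) , λ x → trans (+-cong (zeroˡ _) ≈-refl) (trans (+-identityˡ _) (e x)))

  ∈-⊑ : ∀ {k m} {A : Fam k} {B : Fam m} {v} → A ⊑ B → v ∈⟨ A ⟩ → v ∈⟨ B ⟩
  ∈-⊑ {zero} {B = B} A⊑B (span (cs , e)) = ∈-resp-≋ e (𝟎-∈ B)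
  ∈-⊑ {suc k} A⊑B (span (cs , e)) =
    ∈-resp-≋ e (⊕-∈ (·-∈ (cs zero) (at A⊑B zero)) (∈-⊑ (span⊑ (at A⊑B ∘ suc)) (span ((cs ∘ suc) , ≋-refl))))

  ⊑-refl : ∀ {k} (A : Fam k) → A ⊑ A
  ⊑-refl A = span⊑ (generator-∈ A)

  ⊑-trans : ∀ {k m p} {A : Fam k} {B : Fam m} {C : Fam p} → A ⊑ B → B ⊑ C → A ⊑ C
  ⊑-trans A⊑B B⊑C = span⊑ λ i → ∈-⊑ B⊑C (at A⊑B i)

  ◁-⊑ : ∀ {k m} {u} {A : Fam k} {B : Fam m} → u ∈⟨ B ⟩ → A ⊑ B → (u ◁ A) ⊑ B
  ◁-⊑ u∈B A⊑B = span⊑ λ { zero → u∈B ; (suc i) → at A⊑B i }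

  ⊑-◁ : ∀ {k m} {A : Fam k} {B : Fam m} u → A ⊑ B → A ⊑ (u ◁ B)
  ⊑-◁ u A⊑B = span⊑ λ i → ∈-◁ u (at A⊑B i)

  ◁-mono : ∀ {k m} {A : Fam k} {B : Fam m} u → A ⊑ B → (u ◁ A) ⊑ (u ◁ B)
  ◁-mono u A⊑B = ◁-⊑ (generator-∈ (u ◁ _) zero) (⊑-◁ u A⊑B)

  𝟎≋? : ∀ v → Dec (𝟎 ≋ v)
  𝟎≋? v = FinP.all? (λ i → 0# ≈? v i)

  _∈?⟨_⟩ : ∀ {k} v (B : Fam k) → Dec (v ∈⟨ B ⟩)
  _∈?⟨_⟩ {zero} v B with 𝟎≋? v
  ... | yes 𝟎≋v = yes (span ((λ ()) , 𝟎≋v))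
  ... | no 𝟎≉v = no λ { (span (_ , 𝟎≋v)) → 𝟎≉v 𝟎≋v }
  _∈?⟨_⟩ {suc k} v B with FinP.any? (λ a → (v ⊕ ((- enum a) · B zero)) ∈?⟨ B ∘ suc ⟩)
  ... | yes (a , span (cs , e)) = yes (span ((enum a ◁ cs) , λ x →
        trans (+-congˡ (e x)) (trans (+-congˡ (+-congˡ (sym (-‿distribˡ-* _ _)))) (+-cancel-neg _ _))))
  ... | no ∄a = no λ { (span (cs , e)) → ∄a (coordinate (cs zero) , span ((cs ∘ suc) , λ x → begin
        lincomb (cs ∘ suc) (B ∘ suc) x                                     ≈⟨ +-cancel-neg (cs zero * B zero x) _ ⟨
        cs zero * B zero x + (lincomb (cs ∘ suc) (B ∘ suc) x + - (cs zero * B zero x)) ≈⟨ +-assoc _ _ _ ⟨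
        lincomb cs B x + - (cs zero * B zero x)                            ≈⟨ +-cong (e x) (-‿distribˡ-* _ _) ⟩
        v x + - cs zero * B zero x                                         ≈⟨ +-congˡ (*-congʳ (-‿cong (enum-coordinate (cs zero)))) ⟨
        v x + - enum (coordinate (cs zero)) * B zero x                     ∎)) }
    where
    coordinate : Carrier → Fin q
    coordinate a = proj₁ (enum-surjective a)
    enum-coordinate : ∀ a → enum (coordinate a) ≈ a
    enum-coordinate a = proj₂ (enum-surjective a)

  _⊑?_ : ∀ {k m} (A : Fam k) (B : Fam m) → Dec (A ⊑ B)
  A ⊑? B with FinP.all? (λ i → A i ∈?⟨ B ⟩)
  ... | yes A⊑B = yes (span⊑ A⊑B)
  ... | no A⋢B = no λ A⊑B → A⋢B (at A⊑B)

  ⋢⇒∃∉ : ∀ {k m} {A : Fam k} {B : Fam m} → ¬ A ⊑ B → ∃ λ i → ¬ A i ∈⟨ B ⟩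
  ⋢⇒∃∉ {k} {A = A} {B} A⋢B = FinP.¬∀⟶∃¬ k (λ i → A i ∈⟨ B ⟩) (λ i → A i ∈?⟨ B ⟩) (A⋢B ∘ span⊑)

  LinIndep-tail : ∀ {k} {V : Fam (suc k)} → LinIndep V → LinIndep (V ∘ suc)
  LinIndep-tail V-indep cs e i = V-indep (0# ◁ cs) (λ x → trans (+-cong (zeroˡ _) (e x)) (+-identityˡ 0#)) (suc i)

  LinIndep-◁ : ∀ {k} {B : Fam k} {u} → LinIndep B → ¬ u ∈⟨ B ⟩ → LinIndep (u ◁ B)
  LinIndep-◁ {B = B} {u} B-indep u∉B cs e with cs zero ≈? 0#
  ... | yes c₀≈0 = λ { zero → c₀≈0 ; (suc i) → B-indep (cs ∘ suc) (λ x → drop-zero-term c₀≈0 (e x)) i }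
  ... | no c₀≉0 = ⊥-elim (u∉B (span ((λ i → - c₀⁻¹ * cs (suc i)) , ≋-trans (lincomb-* (- c₀⁻¹) (cs ∘ suc) B) λ x → begin
        - c₀⁻¹ * lincomb (cs ∘ suc) B x ≈⟨ *-congˡ (inverseʳ-unique _ _ (e x)) ⟩
        - c₀⁻¹ * - (cs zero * u x)      ≈⟨ neg*neg _ _ ⟩
        c₀⁻¹ * (cs zero * u x)          ≈⟨ *-assoc _ _ _ ⟨
        c₀⁻¹ * cs zero * u x            ≈⟨ *-congʳ (inv-l _ c₀≉0) ⟩
        1# * u x                        ≈⟨ *-identityˡ _ ⟩
        u x                             ∎)))
    where c₀⁻¹ = inv (cs zero) c₀≉0

  LinIndep-shear : ∀ {k} {V : Fam (suc k)} → LinIndep V → ∀ j (μ : Fin k → Carrier) →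
                   LinIndep (λ i → V (punchIn j i) ⊕ (μ i · V j))
  LinIndep-shear {V = V} V-indep j μ cs e i =
    ≡.subst (_≈ 0#) (insertAt-punchIn cs j s i) (V-indep ds ds·V≋𝟎 (punchIn j i))
    where
    s = sum (λ t → cs t * μ t)
    ds = insertAt cs j s
    ds·V≋𝟎 : lincomb ds V ≋ 𝟎
    ds·V≋𝟎 x = begin
      lincomb ds V x                                                  ≈⟨ lincomb-punchIn ds V j x ⟩
      ds j * V j x + lincomb (ds ∘ punchIn j) (V ∘ punchIn j) x       ≈⟨ +-cong (*-congʳ (reflexive (insertAt-lookup cs j s)))
                                                                          (lincomb-cong (reflexive ∘ insertAt-punchIn cs j s) (λ _ → ≋-refl) x) ⟩
      s * V j x + lincomb cs (V ∘ punchIn j) x                        ≈⟨ +-comm _ _ ⟩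
      lincomb cs (V ∘ punchIn j) x + s * V j x                        ≈⟨ +-congˡ (lincomb-multiples cs μ (V j) x) ⟨
      lincomb cs (V ∘ punchIn j) x + lincomb cs (λ t → μ t · V j) x   ≈⟨ lincomb-⊕ cs (V ∘ punchIn j) (λ t → μ t · V j) x ⟨
      lincomb cs (λ t → V (punchIn j t) ⊕ (μ t · V j)) x             ≈⟨ e x ⟩
      0#                                                              ∎

  -- Gaussian elimination of the coordinate b against the pivot row with coefficient γ, where g = γ⁻¹.
  eliminate-coordinate : ∀ c₁ γ g b r₁ r₂ v₁ v₂ → g * γ ≈ 1# → c₁ * b + r₁ ≈ v₁ → γ * b + r₂ ≈ v₂ →
                         r₁ + (- (c₁ * g)) * r₂ ≈ v₁ + (- (c₁ * g)) * v₂
  eliminate-coordinate c₁ γ g b r₁ r₂ v₁ v₂ gγ≈1 e₁ e₂ = sym (begin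
    v₁ + μ * v₂                         ≈⟨ +-cong (sym e₁) (*-congˡ (sym e₂)) ⟩
    (c₁ * b + r₁) + μ * (γ * b + r₂)    ≈⟨ +-congˡ (distribˡ μ _ _) ⟩
    (c₁ * b + r₁) + (μ * (γ * b) + μ * r₂) ≈⟨ +-interchange _ _ _ _ ⟩
    (c₁ * b + μ * (γ * b)) + (r₁ + μ * r₂) ≈⟨ +-congʳ cancelled ⟩
    0# + (r₁ + μ * r₂)                  ≈⟨ +-identityˡ _ ⟩
    r₁ + μ * r₂                         ∎)
    where
    μ = - (c₁ * g)
    μγ≈-c₁ : μ * γ ≈ - c₁
    μγ≈-c₁ = trans (sym (-‿distribˡ-* _ _)) (-‿cong (trans (*-assoc _ _ _) (trans (*-congˡ gγ≈1) (*-identityʳ c₁))))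
    cancelled : c₁ * b + μ * (γ * b) ≈ 0#
    cancelled = trans (+-congˡ (trans (sym (*-assoc _ _ _)) (trans (*-congʳ μγ≈-c₁) (sym (-‿distribˡ-* _ _))))) (-‿inverseʳ _)

  -- Eliminate the first coordinate of B with a pivot vector of V; without a pivot, the tail of V already works.
  drop-generator : ∀ {k} {B : Fam (suc k)} {V : Fam (suc (suc k))} → V ⊑ B → LinIndep V →
                   Σ (Fam (suc k)) λ W → W ⊑ (B ∘ suc) × LinIndep W
  drop-generator {k} {B} {V} V⊑B V-indep with FinP.any? (λ j → ¬? (coefficients V⊑B j zero ≈? 0#))
  ... | no ∄pivot = V ∘ suc , span⊑ (λ i → span ((C (suc i) ∘ suc) , λ x →
                      drop-zero-term (pivot-free (suc i)) (proj₂ (combination (at V⊑B (suc i))) x))) , LinIndep-tail {V = V} V-indep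
    where
    C = coefficients V⊑B
    pivot-free : ∀ j → C j zero ≈ 0#
    pivot-free j with C j zero ≈? 0#
    ... | yes c≈0 = c≈0
    ... | no c≉0 = ⊥-elim (∄pivot (j , c≉0))
  ... | yes (j , pivot≉0) = W , span⊑ W∈ , LinIndep-shear {V = V} V-indep j μ
    where
    C = coefficients V⊑B
    g = inv (C j zero) pivot≉0
    μ : Fin (suc k) → Carrier
    μ i = - (C (punchIn j i) zero * g)
    W : Fam (suc k)
    W i = V (punchIn j i) ⊕ (μ i · V j)
    W∈ : ∀ i → W i ∈⟨ B ∘ suc ⟩
    W∈ i = span ((λ t → C (punchIn j i) (suc t) + μ i * C j (suc t)) , λ x →
      trans (lincomb-+ _ _ (B ∘ suc) x)
        (trans (+-congˡ (lincomb-* (μ i) (C j ∘ suc) (B ∘ suc) x))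
          (eliminate-coordinate _ _ g _ _ _ _ _ (inv-l _ pivot≉0)
            (proj₂ (combination (at V⊑B (punchIn j i))) x) (proj₂ (combination (at V⊑B j)) x))))

  ⊑-fewer⇒¬LinIndep : ∀ {k} {B : Fam k} {V : Fam (suc k)} → V ⊑ B → ¬ LinIndep V
  ⊑-fewer⇒¬LinIndep {zero} {V = V} V⊑B V-indep = 1≉0 (V-indep (λ _ → 1#) V₀≋𝟎 zero)
    where
    V₀≋𝟎 : lincomb (λ _ → 1#) V ≋ 𝟎
    V₀≋𝟎 x = trans (+-identityʳ _) (trans (*-identityˡ _) (sym (proj₂ (combination (at V⊑B zero)) x)))
  ⊑-fewer⇒¬LinIndep {suc k} V⊑B V-indep with drop-generator V⊑B V-indep
  ... | W , W⊑B , W-indep = ⊑-fewer⇒¬LinIndep W⊑B W-indep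

  LinIndep-◁⇒∉ : ∀ {k} {B : Fam k} {u} → LinIndep (u ◁ B) → ¬ u ∈⟨ B ⟩
  LinIndep-◁⇒∉ {B = B} u◁B-indep u∈B = ⊑-fewer⇒¬LinIndep (◁-⊑ u∈B (⊑-refl B)) u◁B-indep

  LinIndep-⊑⇒⊒ : ∀ {k} {A B : Fam k} → LinIndep A → A ⊑ B → B ⊑ A
  LinIndep-⊑⇒⊒ {A = A} {B} A-indep A⊑B = span⊑ λ j → case B j ∈?⟨ A ⟩ of λ where
    (yes Bj∈A) → Bj∈A
    (no Bj∉A) → ⊥-elim (⊑-fewer⇒¬LinIndep (◁-⊑ (generator-∈ B j) A⊑B) (LinIndep-◁ A-indep Bj∉A))

  ∃-generator-∉ : ∀ {k} (A : Fam k) {B : Fam (suc k)} → LinIndep B → ∃ λ j → ¬ B j ∈⟨ A ⟩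
  ∃-generator-∉ A {B} B-indep with B ⊑? A
  ... | yes B⊑A = ⊥-elim (⊑-fewer⇒¬LinIndep B⊑A B-indep)
  ... | no B⋢A = ⋢⇒∃∉ B⋢A

  pointOn : Vect → Vect → Fin (suc q) → Vect
  pointOn u v zero = v
  pointOn u v (suc t) = u ⊕ (enum t · v)

  direction : Carrier → Carrier → Fin (suc q)
  direction α β with α ≈? 0#
  ... | yes _ = zero
  ... | no α≉0 = suc (proj₁ (enum-surjective (β * inv α α≉0)))

  ∃-multiple-of-pointOn : ∀ u v α β → ¬ (α ≈ 0# × β ≈ 0#) →
    ∃ λ κ → ¬ κ ≈ 0# × ((α · u) ⊕ (β · v)) ≋ (κ · pointOn u v (direction α β))
  ∃-multiple-of-pointOn u v α β α,β≉0 with α ≈? 0#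
  ... | yes α≈0 = β , (λ β≈0 → α,β≉0 (α≈0 , β≈0)) , λ x → trans (+-congʳ (trans (*-congʳ α≈0) (zeroˡ _))) (+-identityˡ _)
  ... | no α≉0 = α , α≉0 , λ x → sym (trans (distribˡ α (u x) _) (+-congˡ (trans (sym (*-assoc _ _ _)) (*-congʳ α·t≈β))))
    where
    α·t≈β : α * enum (proj₁ (enum-surjective (β * inv α α≉0))) ≈ β
    α·t≈β = trans (*-congˡ (proj₂ (enum-surjective _)))
             (trans (*-comm _ _) (trans (*-assoc _ _ _) (trans (*-congˡ (inv-l α α≉0)) (*-identityʳ β))))

  -- The subspaces ⟨pointOn u v c , B⟩ form the pencil of q + 1 subspaces between ⟨B⟩ and ⟨u , v , B⟩.
  ∈-pencil : ∀ {k} (B : Fam k) u v {w} → w ∈⟨ u ◁ v ◁ B ⟩ → ¬ w ∈⟨ B ⟩ →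
             ∃ λ c → w ∈⟨ pointOn u v c ◁ B ⟩ × pointOn u v c ∈⟨ w ◁ B ⟩
  ∈-pencil B u v {w} (span (cs , e)) w∉B with ∃-multiple-of-pointOn u v (cs zero) (cs (suc zero)) α,β≉0
    where
    α,β≉0 : ¬ (cs zero ≈ 0# × cs (suc zero) ≈ 0#)
    α,β≉0 (α≈0 , β≈0) = w∉B (span ((λ i → cs (suc (suc i))) , λ x → drop-zero-term β≈0 (drop-zero-term α≈0 (e x))))
  ... | κ , κ≉0 , αu+βv≋κz = direction (cs zero) (cs (suc zero)) ,
      span ((κ ◁ R) , λ x → trans (+-congʳ (sym (αu+βv≋κz x))) (trans (+-assoc _ _ _) (e x))) ,
      ∈-resp-≋ z≋ (⊕-∈ (·-∈ κ⁻¹ (generator-∈ (w ◁ B) zero)) (·-∈ (- κ⁻¹) (∈-◁ w (span (R , ≋-refl)))))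
    where
    R = λ i → cs (suc (suc i))
    κ⁻¹ = inv κ κ≉0
    z = pointOn u v (direction (cs zero) (cs (suc zero)))
    z≋ : ((κ⁻¹ · w) ⊕ ((- κ⁻¹) · lincomb R B)) ≋ z
    z≋ x = begin
      κ⁻¹ * w x + (- κ⁻¹) * r                                             ≈⟨ +-cong (*-congˡ (sym (e x))) (sym (-‿distribˡ-* _ _)) ⟩
      κ⁻¹ * (cs zero * u x + (cs (suc zero) * v x + r)) + - (κ⁻¹ * r)    ≈⟨ +-congʳ (*-congˡ (sym (+-assoc _ _ _))) ⟩
      κ⁻¹ * ((cs zero * u x + cs (suc zero) * v x) + r) + - (κ⁻¹ * r)    ≈⟨ +-congʳ (*-congˡ (+-congʳ (αu+βv≋κz x))) ⟩
      κ⁻¹ * (κ * z x + r) + - (κ⁻¹ * r)                                   ≈⟨ +-congʳ (distribˡ _ _ _) ⟩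
      (κ⁻¹ * (κ * z x) + κ⁻¹ * r) + - (κ⁻¹ * r)                           ≈⟨ +-assoc _ _ _ ⟩
      κ⁻¹ * (κ * z x) + (κ⁻¹ * r + - (κ⁻¹ * r))                           ≈⟨ +-congˡ (-‿inverseʳ _) ⟩
      κ⁻¹ * (κ * z x) + 0#                                                ≈⟨ +-identityʳ _ ⟩
      κ⁻¹ * (κ * z x)                                                     ≈⟨ *-assoc _ _ _ ⟨
      κ⁻¹ * κ * z x                                                       ≈⟨ *-congʳ (inv-l κ κ≉0) ⟩
      1# * z x                                                            ≈⟨ *-identityˡ _ ⟩
      z x                                                                 ∎
      where r = lincomb R B x

module Lines {c ℓ} (F : Field c ℓ) {q : ℕ} (F-order : HasOrder F q) (n : ℕ)
             (L : List (PG.Line F n)) (L-set : PG.LineSet F n L) where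

  open PG F n
  open LinearAlgebra F F-order n
  open Counting

  Idx : Set
  Idx = Fin (length L)

  line : Idx → Fam 2
  line i = basis (lookup L i)

  line-indep : ∀ i → LinIndep (line i)
  line-indep i = independent (lookup L i)

  ⊆⇒⊑ : ∀ {d e} {X : Sub d} {Y : Sub e} → X ⊆ Y → basis X ⊑ basis Y
  ⊆⇒⊑ X⊆Y = span⊑ (span ∘ X⊆Y)

  ⊑⇒⊆ : ∀ {d e} {X : Sub d} {Y : Sub e} → basis X ⊑ basis Y → X ⊆ Y
  ⊑⇒⊆ X⊑Y = combination ∘ at X⊑Y

  _⊆?_ : ∀ {d e} (X : Sub d) (Y : Sub e) → Dec (X ⊆ Y)
  X ⊆? Y with basis X ⊑? basis Y
  ... | yes X⊑Y = yes (⊑⇒⊆ {X = X} {Y} X⊑Y)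
  ... | no X⋢Y = no (X⋢Y ∘ ⊆⇒⊑ {X = X} {Y})

  ≐-sym : ∀ {d e} {X : Sub d} {Y : Sub e} → X ≐ Y → Y ≐ X
  ≐-sym (X⊆Y , Y⊆X) = Y⊆X , X⊆Y

  ≐-trans : ∀ {X Y Z : Point} → X ≐ Y → Y ≐ Z → X ≐ Z
  ≐-trans {X} {Y} {Z} (X⊆Y , Y⊆X) (Y⊆Z , Z⊆Y) =
    ⊑⇒⊆ {X = X} {Z} (⊑-trans (⊆⇒⊑ {X = X} {Y} X⊆Y) (⊆⇒⊑ {X = Y} {Z} Y⊆Z)) ,
    ⊑⇒⊆ {X = Z} {X} (⊑-trans (⊆⇒⊑ {X = Z} {Y} Z⊆Y) (⊆⇒⊑ {X = Y} {X} Y⊆X))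

  _≐?_ : ∀ (X Y : Point) → Dec (X ≐ Y)
  X ≐? Y = (X ⊆? Y) ×-dec (Y ⊆? X)

  through : Point → Idx → Set (c ⊔ ℓ)
  through X i = basis X ⊑ line i

  through? : ∀ X → Decidable (through X)
  through? X i = basis X ⊑? line i

  within : ∀ {k} → Fam k → Idx → Set (c ⊔ ℓ)
  within B i = line i ⊑ B

  within? : ∀ {k} (B : Fam k) → Decidable (within B)
  within? B i = line i ⊑? B

  NumLinesIn⇒count : ∀ {d k} (Y : Sub d) → NumLinesIn L Y k → k ≡ count (within? (basis Y))
  NumLinesIn⇒count Y #Y = ≡.trans (CountIs⇒count (_⊆? Y) #Y)
    (count-cong _ _ (λ {i} → ⊆⇒⊑ {X = lookup L i} {Y}) (λ {i} → ⊑⇒⊆ {X = lookup L i} {Y}))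

  NumLinesThrough⇒count : ∀ {k} (X : Point) → NumLinesThrough L X k → k ≡ count (through? X)
  NumLinesThrough⇒count X #X = ≡.trans (CountIs⇒count (X ⊆?_) #X)
    (count-cong _ _ (λ {i} → ⊆⇒⊑ {X = X} {lookup L i}) (λ {i} → ⊑⇒⊆ {X = X} {lookup L i}))

  IsMPoint⇒count : ∀ {d} (M : Sub d) (X : Point) → IsMPoint q L M X →
                   suc q ≡ count (within? (basis M) ∩? through? X)
  IsMPoint⇒count M X #MX = ≡.trans (CountIs⇒count (λ l → (l ⊆? M) ×-dec (X ⊆? l)) #MX)
    (count-cong _ _ (λ {i} → Data.Product.map (⊆⇒⊑ {X = lookup L i} {M}) (⊆⇒⊑ {X = X} {lookup L i}))
                    (λ {i} → Data.Product.map (⊑⇒⊆ {X = lookup L i} {M}) (⊑⇒⊆ {X = X} {lookup L i})))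

  ≐⇒≡ : ∀ {i j} → lookup L i ≐ lookup L j → i ≡ j
  ≐⇒≡ {i} {j} i≐j with i FinP.≟ j
  ... | yes i≡j = i≡j
  ... | no i≢j with AllPairs-lookup L-set i≢j
  ... | inj₁ i≭j = ⊥-elim (i≭j i≐j)
  ... | inj₂ j≭i = ⊥-elim (j≭i (≐-sym {X = lookup L i} {lookup L j} i≐j))

  within-line⇒≡ : ∀ {Y : Fam 2} → LinIndep Y → ∀ {i j} → within Y i → within Y j → i ≡ j
  within-line⇒≡ Y-indep {i} {j} i⊑Y j⊑Y =
    ≐⇒≡ (⊑⇒⊆ {X = lookup L i} {lookup L j} (⊑-trans i⊑Y (LinIndep-⊑⇒⊒ (line-indep j) j⊑Y)) ,
         ⊑⇒⊆ {X = lookup L j} {lookup L i} (⊑-trans j⊑Y (LinIndep-⊑⇒⊒ (line-indep i) i⊑Y)))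

  point-⊑ : ∀ {k} {B : Fam k} (X : Point) → basis X zero ∈⟨ B ⟩ → basis X ⊑ B
  point-⊑ X X∈B = span⊑ λ { zero → X∈B }

  ≭⇒∉ : ∀ {X Y : Point} → ¬ X ≐ Y → ¬ basis Y zero ∈⟨ basis X ⟩
  ≭⇒∉ {X} {Y} X≭Y Y∈X =
    X≭Y (⊑⇒⊆ {X = X} {Y} (LinIndep-⊑⇒⊒ (independent Y) (point-⊑ Y Y∈X)) , ⊑⇒⊆ {X = Y} {X} (point-⊑ Y Y∈X))

  through-∉⇒⊑ : ∀ {X : Point} {i w} → through X i → w ∈⟨ line i ⟩ → ¬ w ∈⟨ basis X ⟩ → within (w ◁ basis X) i
  through-∉⇒⊑ {X} X∈i w∈i w∉X = LinIndep-⊑⇒⊒ (LinIndep-◁ (independent X) w∉X) (◁-⊑ w∈i X∈i)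

  ∃-off-point : ∀ (X : Point) i → ∃ λ t → ¬ line i t ∈⟨ basis X ⟩
  ∃-off-point X i = ∃-generator-∉ (basis X) (line-indep i)

  through-two-points-≤1 : ∀ {X Y : Point} → ¬ X ≐ Y → count (through? X ∩? through? Y) ≤ 1
  through-two-points-≤1 {X} {Y} X≭Y = count-≤1 (through? X ∩? through? Y) λ (X∈i , Y∈i) (X∈j , Y∈j) →
    within-line⇒≡ (LinIndep-◁ (independent X) (≭⇒∉ {X} {Y} X≭Y))
      (through-∉⇒⊑ {X} X∈i (at Y∈i zero) (≭⇒∉ {X} {Y} X≭Y)) (through-∉⇒⊑ {X} X∈j (at Y∈j zero) (≭⇒∉ {X} {Y} X≭Y))

  within-meet : ∀ {k} {Y : Fam k} {Π Π′ : Fam (suc k)} → LinIndep Y → Y ⊑ Π → Y ⊑ Π′ → ¬ Π ⊑ Π′ →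
                ∀ {i} → within Π i → within Π′ i → within Y i
  within-meet {Y = Y} Y-indep Y⊑Π Y⊑Π′ Π⋢Π′ {i} i⊑Π i⊑Π′ with line i ⊑? Y
  ... | yes i⊑Y = i⊑Y
  ... | no i⋢Y with ⋢⇒∃∉ i⋢Y
  ... | t , t∉Y = ⊥-elim (Π⋢Π′ (⊑-trans (LinIndep-⊑⇒⊒ (LinIndep-◁ Y-indep t∉Y) (◁-⊑ (at i⊑Π t) Y⊑Π)) (◁-⊑ (at i⊑Π′ t) Y⊑Π′)))

  count-within-meet-≤1 : ∀ {Y : Fam 2} {Π Π′ : Fam 3} → LinIndep Y → Y ⊑ Π → Y ⊑ Π′ → ¬ Π ⊑ Π′ →
                         count (within? Π ∩? within? Π′) ≤ 1
  count-within-meet-≤1 {Π = Π} {Π′} Y-indep Y⊑Π Y⊑Π′ Π⋢Π′ =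
    count-≤1 (within? Π ∩? within? Π′) λ (i⊑Π , i⊑Π′) (j⊑Π , j⊑Π′) →
      within-line⇒≡ Y-indep (within-meet Y-indep Y⊑Π Y⊑Π′ Π⋢Π′ i⊑Π i⊑Π′) (within-meet Y-indep Y⊑Π Y⊑Π′ Π⋢Π′ j⊑Π j⊑Π′)

module Configuration {c ℓ} (F : Field c ℓ) {q : ℕ} (F-order : HasOrder F q) (n : ℕ)
  (L : List (PG.Line F n)) (L-set : PG.LineSet F n L)
  (Pt : ∀ (P : PG.Point F n) → ∃ λ k → PG.NumLinesThrough F n L P k × (k ≡ 0 ⊎ k ≡ q Nat.+ 1))
  (Pl : ∀ (π : PG.Plane F n) → ∃ λ k → PG.NumLinesIn F n L π k × (k ≡ 0 ⊎ k ≡ 1 ⊎ k ≡ q Nat.+ 1))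
  (Sd : ∀ (S : PG.Solid F n) → ∃ λ k → PG.NumLinesIn F n L S k × (k ≡ 0 ⊎ k ≡ 1 ⊎ k ≡ q Nat.+ 1 ⊎ k ≡ 2 Nat.* q Nat.+ 1))
  where

  open Nat using (_+_; _*_)
  open PG F n
  open LinearAlgebra F F-order n
  open Lines F F-order n L L-set
  open Counting

  full-plane : ∀ {Π : Fam 3} → LinIndep Π → ∀ {i j} → i ≢ j → within Π i → within Π j → count (within? Π) ≡ q + 1
  full-plane {Π} Π-indep {i} {j} i≢j i⊑Π j⊑Π with Pl (sub Π Π-indep)
  ... | k , #Π , k-cases = ≡.trans (≡.sym k≡#) (plane-size k-cases (≡.subst (2 ≤_) (≡.sym k≡#) two-lines))
    where
    k≡# = NumLinesIn⇒count (sub Π Π-indep) #Π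
    two-lines = 2≤count (within? Π) i≢j i⊑Π j⊑Π
    plane-size : ∀ {k} → k ≡ 0 ⊎ k ≡ 1 ⊎ k ≡ q + 1 → 2 ≤ k → k ≡ q + 1
    plane-size (inj₁ ≡.refl) ()
    plane-size (inj₂ (inj₁ ≡.refl)) (s≤s ())
    plane-size (inj₂ (inj₂ k≡q+1)) _ = k≡q+1

  solid-≤ : ∀ {S : Fam 4} → LinIndep S → count (within? S) ≤ 2 * q + 1
  solid-≤ {S} S-indep with Sd (sub S S-indep)
  ... | k , #S , k-cases = ≡.subst (_≤ 2 * q + 1) (NumLinesIn⇒count (sub S S-indep) #S) (solid-size k-cases)
    where
    solid-size : ∀ {k} → k ≡ 0 ⊎ k ≡ 1 ⊎ k ≡ q + 1 ⊎ k ≡ 2 * q + 1 → k ≤ 2 * q + 1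
    solid-size (inj₁ ≡.refl) = z≤n
    solid-size (inj₂ (inj₁ ≡.refl)) = ℕP.m≤n+m 1 (2 * q)
    solid-size (inj₂ (inj₂ (inj₁ ≡.refl))) = ℕP.+-monoˡ-≤ 1 (ℕP.m≤m+n q (q + 0))
    solid-size (inj₂ (inj₂ (inj₂ ≡.refl))) = ℕP.≤-refl

  ¬lines-through-span-solid : ∀ {X : Point} {i₁ i₂ i a b u} → i₁ ≢ i₂ →
    through X i₁ → through X i₂ → through X i → a ∈⟨ line i₁ ⟩ → b ∈⟨ line i₂ ⟩ → u ∈⟨ line i ⟩ →
    ¬ LinIndep (u ◁ b ◁ a ◁ basis X)
  ¬lines-through-span-solid {X} {i₁} {i₂} {i} {a} {b} {u} i₁≢i₂ X∈i₁ X∈i₂ X∈i a∈i₁ b∈i₂ u∈i S-indep =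
    no-three-large-within (within? Π) (within? Π₂) (within? S) (within? Π₃) 2≤q
      (λ i⊑ → ⊑-trans i⊑ Π⊑S) (λ i⊑ → ⊑-trans i⊑ Π₂⊑S) (λ i⊑ → ⊑-trans i⊑ Π₃⊑S)
      (full-plane Π-indep i₁≢i₂ (⊑-trans i₁⊑aX aX⊑Π) (⊑-trans i₂⊑bX bX⊑Π))
      (full-plane Π₂-indep (λ i₁≡i → u∉Π (∈-⊑ (≡.subst (within Π) i₁≡i (⊑-trans i₁⊑aX aX⊑Π)) u∈i))
                  (⊑-trans i₁⊑aX aX⊑Π₂) (⊑-trans i⊑uX uX⊑Π₂))
      (full-plane Π₃-indep (λ i₂≡i → u∉Π (∈-⊑ (≡.subst (within Π) i₂≡i (⊑-trans i₂⊑bX bX⊑Π)) u∈i))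
                  (⊑-trans i₂⊑bX bX⊑Π₃) (⊑-trans i⊑uX uX⊑Π₃))
      (solid-≤ S-indep)
      (count-within-meet-≤1 aX-indep aX⊑Π aX⊑Π₂ λ Π⊑Π₂ → S⋢plane (◁-⊑ (generator-∈ Π₂ zero) Π⊑Π₂))
      (count-within-meet-≤1 bX-indep bX⊑Π bX⊑Π₃ λ Π⊑Π₃ → S⋢plane (◁-⊑ (generator-∈ Π₃ zero) Π⊑Π₃))
      (count-within-meet-≤1 uX-indep uX⊑Π₂ uX⊑Π₃ λ Π₂⊑Π₃ →
        S⋢plane (◁-⊑ (generator-∈ Π₃ zero) (◁-⊑ (generator-∈ Π₃ (suc zero)) (◁-⊑ (∈-⊑ Π₂⊑Π₃ (generator-∈ Π₂ (suc zero))) X⊑Π₃))))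
    where
    Xb = basis X
    Π = b ◁ a ◁ Xb
    Π₂ = u ◁ a ◁ Xb
    Π₃ = u ◁ b ◁ Xb
    S = u ◁ Π
    Π-indep : LinIndep Π
    Π-indep = LinIndep-tail {V = S} S-indep
    aX-indep : LinIndep (a ◁ Xb)
    aX-indep = LinIndep-tail {V = Π} Π-indep
    aX⊑Π : (a ◁ Xb) ⊑ Π
    aX⊑Π = ⊑-◁ b (⊑-refl _)
    bX⊑Π : (b ◁ Xb) ⊑ Π
    bX⊑Π = ◁-mono b (⊑-◁ a (⊑-refl Xb))
    aX⊑Π₂ : (a ◁ Xb) ⊑ Π₂
    aX⊑Π₂ = ⊑-◁ u (⊑-refl _)
    uX⊑Π₂ : (u ◁ Xb) ⊑ Π₂
    uX⊑Π₂ = ◁-mono u (⊑-◁ a (⊑-refl Xb))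
    bX⊑Π₃ : (b ◁ Xb) ⊑ Π₃
    bX⊑Π₃ = ⊑-◁ u (⊑-refl _)
    uX⊑Π₃ : (u ◁ Xb) ⊑ Π₃
    uX⊑Π₃ = ◁-mono u (⊑-◁ b (⊑-refl Xb))
    X⊑Π₃ : Xb ⊑ Π₃
    X⊑Π₃ = ⊑-◁ u (⊑-◁ b (⊑-refl Xb))
    Π⊑S : Π ⊑ S
    Π⊑S = ⊑-◁ u (⊑-refl Π)
    Π₂⊑S : Π₂ ⊑ S
    Π₂⊑S = ◁-mono u aX⊑Π
    Π₃⊑S : Π₃ ⊑ S
    Π₃⊑S = ◁-mono u bX⊑Π
    S⋢plane : ∀ {T : Fam 3} → ¬ S ⊑ T
    S⋢plane S⊑T = ⊑-fewer⇒¬LinIndep S⊑T S-indep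
    u∉Π : ¬ u ∈⟨ Π ⟩
    u∉Π = LinIndep-◁⇒∉ S-indep
    a∉X : ¬ a ∈⟨ Xb ⟩
    a∉X = LinIndep-◁⇒∉ aX-indep
    b∉X : ¬ b ∈⟨ Xb ⟩
    b∉X = LinIndep-◁⇒∉ {B = a ◁ Xb} Π-indep ∘ ∈-◁ a
    u∉X : ¬ u ∈⟨ Xb ⟩
    u∉X = u∉Π ∘ ∈-◁ b ∘ ∈-◁ a
    bX-indep : LinIndep (b ◁ Xb)
    bX-indep = LinIndep-◁ (independent X) b∉X
    uX-indep : LinIndep (u ◁ Xb)
    uX-indep = LinIndep-◁ (independent X) u∉X
    Π₂-indep : LinIndep Π₂
    Π₂-indep = LinIndep-◁ aX-indep (u∉Π ∘ ∈-⊑ aX⊑Π)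
    Π₃-indep : LinIndep Π₃
    Π₃-indep = LinIndep-◁ bX-indep (u∉Π ∘ ∈-⊑ bX⊑Π)
    i₁⊑aX : within (a ◁ Xb) i₁
    i₁⊑aX = through-∉⇒⊑ {X} X∈i₁ a∈i₁ a∉X
    i₂⊑bX : within (b ◁ Xb) i₂
    i₂⊑bX = through-∉⇒⊑ {X} X∈i₂ b∈i₂ b∉X
    i⊑uX : within (u ◁ Xb) i
    i⊑uX = through-∉⇒⊑ {X} X∈i u∈i u∉X

  record PlaneOf (X : Point) : Set (c ⊔ ℓ) where
    field
      {i₁ i₂} : Idx
      i₁≢i₂ : i₁ ≢ i₂
      X∈i₁ : through X i₁
      X∈i₂ : through X i₂
      {a b} : Vect
      a∈i₁ : a ∈⟨ line i₁ ⟩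
      b∈i₂ : b ∈⟨ line i₂ ⟩
      plane-indep : LinIndep (b ◁ a ◁ basis X)
      lines⊑plane : ∀ {i} → through X i → within (b ◁ a ◁ basis X) i

    plane : Fam 3
    plane = b ◁ a ◁ basis X

    X⊑plane : basis X ⊑ plane
    X⊑plane = ⊑-◁ b (⊑-◁ a (⊑-refl (basis X)))

    plane-full : count (within? plane) ≡ q + 1
    plane-full = full-plane plane-indep i₁≢i₂ (lines⊑plane X∈i₁) (lines⊑plane X∈i₂)

    plane-⊑ : ∀ {k} {B : Fam k} → within B i₁ → within B i₂ → plane ⊑ B
    plane-⊑ i₁⊑B i₂⊑B = ◁-⊑ (∈-⊑ i₂⊑B b∈i₂) (◁-⊑ (∈-⊑ i₁⊑B a∈i₁) (⊑-trans X∈i₁ i₁⊑B))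

  plane-spanned : ∀ (X : Point) {i₁ i₂ a b} → i₁ ≢ i₂ → through X i₁ → through X i₂ →
                  a ∈⟨ line i₁ ⟩ → ¬ a ∈⟨ basis X ⟩ → b ∈⟨ line i₂ ⟩ → ¬ b ∈⟨ basis X ⟩ → PlaneOf X
  plane-spanned X {i₁} {i₂} {a} {b} i₁≢i₂ X∈i₁ X∈i₂ a∈i₁ a∉X b∈i₂ b∉X = record
    { i₁≢i₂ = i₁≢i₂ ; X∈i₁ = X∈i₁ ; X∈i₂ = X∈i₂ ; a∈i₁ = a∈i₁ ; b∈i₂ = b∈i₂ ; plane-indep = Π-indep ; lines⊑plane = lines⊑Π }
    where
    Π = b ◁ a ◁ basis X
    aX-indep : LinIndep (a ◁ basis X)
    aX-indep = LinIndep-◁ (independent X) a∉X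
    b∉aX : ¬ b ∈⟨ a ◁ basis X ⟩
    b∉aX b∈aX = i₁≢i₂ (within-line⇒≡ aX-indep (through-∉⇒⊑ {X} X∈i₁ a∈i₁ a∉X)
                                     (⊑-trans (through-∉⇒⊑ {X} X∈i₂ b∈i₂ b∉X) (◁-⊑ b∈aX (⊑-◁ a (⊑-refl (basis X))))))
    Π-indep : LinIndep Π
    Π-indep = LinIndep-◁ aX-indep b∉aX
    lines⊑Π : ∀ {i} → through X i → within Π i
    lines⊑Π {i} X∈i with line i ⊑? Π
    ... | yes i⊑Π = i⊑Π
    ... | no i⋢Π with ⋢⇒∃∉ i⋢Π
    ... | t , u∉Π = ⊥-elim (¬lines-through-span-solid {X} i₁≢i₂ X∈i₁ X∈i₂ X∈i a∈i₁ b∈i₂ (generator-∈ (line i) t)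
                                                      (LinIndep-◁ Π-indep u∉Π))

  plane-of : ∀ (X : Point) {i₁ i₂} → i₁ ≢ i₂ → through X i₁ → through X i₂ → PlaneOf X
  plane-of X {i₁} {i₂} i₁≢i₂ X∈i₁ X∈i₂ = from-off-points (∃-off-point X i₁) (∃-off-point X i₂)
    where
    from-off-points : (∃ λ t₁ → ¬ line i₁ t₁ ∈⟨ basis X ⟩) → (∃ λ t₂ → ¬ line i₂ t₂ ∈⟨ basis X ⟩) → PlaneOf X
    from-off-points (t₁ , a∉X) (t₂ , b∉X) =
      plane-spanned X i₁≢i₂ X∈i₁ X∈i₂ (generator-∈ (line i₁) t₁) a∉X (generator-∈ (line i₂) t₂) b∉X

  module _ {d} (M : Sub d) (X : Point) (X-M : IsMPoint q L M X) where

    private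
      M∧X? : Decidable (λ i → within (basis M) i × through X i)
      M∧X? = within? (basis M) ∩? through? X

      #M∧X≤#X : suc q ≤ count (through? X)
      #M∧X≤#X = ℕP.≤-trans (ℕP.≤-reflexive (IsMPoint⇒count M X X-M)) (count-mono M∧X? (through? X) proj₂)

    MPoint-count : count (through? X) ≡ q + 1
    MPoint-count with Pt X
    ... | _ , #X , inj₁ ≡.refl = case ℕP.≤-trans #M∧X≤#X (ℕP.≤-reflexive (≡.sym (NumLinesThrough⇒count X #X))) of λ ()
    ... | _ , #X , inj₂ k≡q+1 = ≡.trans (≡.sym (NumLinesThrough⇒count X #X)) k≡q+1

    MPoint-lines⊑M : ∀ {i} → through X i → within (basis M) i
    MPoint-lines⊑M {i} X∈i with within? (basis M) i
    ... | yes i⊑M = i⊑M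
    ... | no i⋢M = ⊥-elim (ℕP.<-irrefl ≡.refl (begin-strict
      suc q                  ≡⟨ IsMPoint⇒count M X X-M ⟩
      count M∧X?             <⟨ count-mono-< M∧X? (through? X) proj₂ X∈i (i⋢M ∘ proj₁) ⟩
      count (through? X)     ≡⟨ MPoint-count ⟩
      q + 1                  ≡⟨ ℕP.+-comm q 1 ⟩
      suc q                  ∎))
      where open ℕP.≤-Reasoning

    MPoint-plane : PlaneOf X
    MPoint-plane = from-two-lines (2≤count⇒∃₂ (through? X) (ℕP.≤-trans (s≤s (ℕP.≤-trans (s≤s z≤n) 2≤q)) #M∧X≤#X))
      where
      from-two-lines : (∃₂ λ i₁ i₂ → i₁ ≢ i₂ × through X i₁ × through X i₂) → PlaneOf X
      from-two-lines (_ , _ , i₁≢i₂ , X∈i₁ , X∈i₂) = plane-of X i₁≢i₂ X∈i₁ X∈i₂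

  module PlaneOfMPoint (M : Sub 4) (P : Point) (P-M : IsMPoint q L M P) (πP : PlaneOf P) where

    open PlaneOf πP using (a; b; plane; plane-indep; lines⊑plane; X⊑plane; plane-full; plane-⊑; X∈i₁; X∈i₂)

    plane⊑M : plane ⊑ basis M
    plane⊑M = plane-⊑ (MPoint-lines⊑M M P P-M X∈i₁) (MPoint-lines⊑M M P P-M X∈i₂)

    InPiP⇒∈ : ∀ {Q} → InPiP L P Q → basis Q zero ∈⟨ plane ⟩
    InPiP⇒∈ (u , u∈span , u≋Q) = ∈-resp-≋ u≋Q (Gen⇒∈ u∈span)
      where
      on-line⇒∈ : ∀ {w} → OnLineThrough L P w → w ∈⟨ plane ⟩
      on-line⇒∈ {w} (l , l∈L , P⊆l , w∈l) = ∈-⊑ (lines⊑plane P∈l) (≡.subst (λ l′ → w ∈⟨ basis l′ ⟩) l≡ (span w∈l))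
        where
        l≡ : l ≡ lookup L (Any.index l∈L)
        l≡ = AnyP.lookup-index l∈L
        P∈l : through P (Any.index l∈L)
        P∈l = ≡.subst (λ l′ → basis P ⊑ basis l′) l≡ (⊆⇒⊑ {X = P} {l} P⊆l)
      Gen⇒∈ : ∀ {v} → Gen (OnLineThrough L P) v → v ∈⟨ plane ⟩
      Gen⇒∈ gen-𝟎 = 𝟎-∈ plane
      Gen⇒∈ (gen-step α w w-on rest) = ⊕-∈ (·-∈ α (on-line⇒∈ w-on)) (Gen⇒∈ rest)

    Pb = basis P

    line-direction : ∀ {i} → through P i → ∃ λ c → within (pointOn b a c ◁ Pb) i × ¬ pointOn b a c ∈⟨ Pb ⟩
    line-direction {i} P∈i = from-off-point (∃-off-point P i)
      where
      from-off-point : (∃ λ t → ¬ line i t ∈⟨ Pb ⟩) → ∃ λ c → within (pointOn b a c ◁ Pb) i × ¬ pointOn b a c ∈⟨ Pb ⟩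
      from-off-point (t , w∉P) = from-pencil (∈-pencil Pb b a (∈-⊑ (lines⊑plane P∈i) w∈i) w∉P)
        where
        w∈i = generator-∈ (line i) t
        from-pencil : (∃ λ c → line i t ∈⟨ pointOn b a c ◁ Pb ⟩ × pointOn b a c ∈⟨ line i t ◁ Pb ⟩) →
                      ∃ λ c → within (pointOn b a c ◁ Pb) i × ¬ pointOn b a c ∈⟨ Pb ⟩
        from-pencil (c , w∈zP , z∈wP) = c , through-∉⇒⊑ {P} P∈i (∈-⊑ (◁-⊑ w∈i P∈i) z∈wP) z∉P , z∉P
          where
          z∉P : ¬ pointOn b a c ∈⟨ Pb ⟩
          z∉P z∈P = w∉P (∈-⊑ (◁-⊑ z∈P (⊑-refl Pb)) w∈zP)

    line-direction-injective : ∀ {i j} (P∈i : through P i) (P∈j : through P j) →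
                               proj₁ (line-direction P∈i) ≡ proj₁ (line-direction P∈j) → i ≡ j
    line-direction-injective {i} {j} P∈i P∈j = same-direction (line-direction P∈i) (line-direction P∈j)
      where
      same-direction : ∀ (x : ∃ λ c → within (pointOn b a c ◁ Pb) i × ¬ pointOn b a c ∈⟨ Pb ⟩)
                         (y : ∃ λ c → within (pointOn b a c ◁ Pb) j × ¬ pointOn b a c ∈⟨ Pb ⟩) → proj₁ x ≡ proj₁ y → i ≡ j
      same-direction (c , i⊑zP , z∉P) (.c , j⊑zP , _) ≡.refl = within-line⇒≡ (LinIndep-◁ (independent P) z∉P) i⊑zP j⊑zP

    -- The q + 1 lines through P have pairwise distinct directions, so every direction is attained.
    PQ-line : ∀ {Q} → basis Q zero ∈⟨ plane ⟩ → ¬ P ≐ Q → ∃ λ i → through P i × through Q i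
    PQ-line {Q} Q∈π P≭Q with FinP.any? (through? P ∩? through? Q)
    ... | yes found = found
    ... | no ∄PQ = ⊥-elim (ℕP.<-irrefl ≡.refl (begin-strict
      q                  <⟨ ℕP.n<1+n q ⟩
      suc q              ≡⟨ ℕP.+-comm 1 q ⟩
      q + 1              ≡⟨ MPoint-count M P P-M ⟨
      count (through? P) ≤⟨ count-≤-injection (through? P) (λ _ P∈i → punchOut (missed P∈i))
                              (λ _ _ P∈i P∈j e → line-direction-injective P∈i P∈j
                                (FinP.punchOut-injective (missed P∈i) (missed P∈j) e)) ⟩
      q                  ∎))
      where
      open ℕP.≤-Reasoning
      Q-direction : ∃ λ c → basis Q zero ∈⟨ pointOn b a c ◁ Pb ⟩ × pointOn b a c ∈⟨ basis Q zero ◁ Pb ⟩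
      Q-direction = ∈-pencil Pb b a Q∈π (≭⇒∉ {P} {Q} P≭Q)
      missed : ∀ {i} (P∈i : through P i) → proj₁ Q-direction ≢ proj₁ (line-direction P∈i)
      missed {i} P∈i = direction-missed (line-direction P∈i)
        where
        direction-missed : (x : ∃ λ c → within (pointOn b a c ◁ Pb) i × ¬ pointOn b a c ∈⟨ Pb ⟩) → proj₁ Q-direction ≢ proj₁ x
        direction-missed (c , i⊑zP , _) e =
          ∄PQ (i , P∈i , point-⊑ Q (∈-⊑ (LinIndep-⊑⇒⊒ (line-indep i) i⊑zP)
                                       (≡.subst (λ c → basis Q zero ∈⟨ pointOn b a c ◁ Pb ⟩) e (proj₁ (proj₂ Q-direction)))))

    Q-leaves-plane : ∀ {Q} → IsMPoint q L M Q → ¬ P ≐ Q → ∃ λ j → through Q j × ¬ within plane j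
    Q-leaves-plane {Q} Q-M P≭Q with FinP.any? (through? Q ∩? (¬? ∘ within? plane))
    ... | yes found = found
    ... | no ∄j = ⊥-elim (no-two-large-within (through? P) (through? Q) (within? plane) (ℕP.≤-trans (s≤s z≤n) 2≤q)
                   lines⊑plane Q-lines⊑plane (MPoint-count M P P-M) (MPoint-count M Q Q-M)
                   (ℕP.≤-reflexive plane-full) (through-two-points-≤1 {P} {Q} P≭Q))
      where
      Q-lines⊑plane : ∀ {j} → through Q j → within plane j
      Q-lines⊑plane {j} Q∈j = decidable-stable (within? plane j) λ j⋢π → ∄j (j , Q∈j , j⋢π)

    -- Padding the plane with 𝟎 to four vectors makes some basis vector of the 4-space M lie outside it.
    ∃-extension-to-M : ∃₂ λ m₅ m₄ → basis M ⊑ (m₅ ◁ m₄ ◁ plane)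
    ∃-extension-to-M = extend (∃-generator-∉ (𝟎 ◁ plane) {basis M} (independent M))
      where
      extend : (∃ λ j₄ → ¬ basis M j₄ ∈⟨ 𝟎 ◁ plane ⟩) → ∃₂ λ m₅ m₄ → basis M ⊑ (m₅ ◁ m₄ ◁ plane)
      extend (j₄ , m₄∉) = extend′ (∃-generator-∉ (basis M j₄ ◁ plane) {basis M} (independent M))
        where
        extend′ : (∃ λ j₅ → ¬ basis M j₅ ∈⟨ basis M j₄ ◁ plane ⟩) → ∃₂ λ m₅ m₄ → basis M ⊑ (m₅ ◁ m₄ ◁ plane)
        extend′ (j₅ , m₅∉) = basis M j₅ , basis M j₄ ,
          LinIndep-⊑⇒⊒ (LinIndep-◁ (LinIndep-◁ plane-indep (m₄∉ ∘ ∈-◁ 𝟎)) m₅∉)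
                        (◁-⊑ (generator-∈ (basis M) j₅) (◁-⊑ (generator-∈ (basis M) j₄) plane⊑M))

  module SolidsThroughPlane (M : Sub 4) (P : Point) (P-M : IsMPoint q L M P) (πP : PlaneOf P)
                            (m₅ m₄ : Vect) (M⊑m₅m₄plane : basis M ⊑ (m₅ ◁ m₄ ◁ PlaneOf.plane πP)) where

    open PlaneOf πP using (plane; plane-indep; lines⊑plane; X⊑plane)
    open PlaneOfMPoint M P P-M πP

    solid : Fin (suc q) → Fam 4
    solid c = pointOn m₅ m₄ c ◁ plane

    record SolidOf (Q : Point) : Set (c ⊔ ℓ) where
      field
        class : Fin (suc q)
        solid-indep : LinIndep (solid class)
        lines⊑solid : ∀ {i} → through Q i → within (solid class) i
    open SolidOf

    -- The plane of Q is ⟨w , Q , P⟩, which lies in the solid of the pencil through the plane of P containing w.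
    solid-from-lines : ∀ {Q} → IsMPoint q L M Q → PlaneOf Q → basis Q zero ∈⟨ plane ⟩ → ¬ P ≐ Q →
      ∀ {i j w} → through P i → through Q i → through Q j → w ∈⟨ line j ⟩ → ¬ w ∈⟨ plane ⟩ → SolidOf Q
    solid-from-lines {Q} Q-M πQ Q∈π P≭Q {i} {j} {w} P∈i Q∈i Q∈j w∈j w∉π = from-pencil (∈-pencil plane m₅ m₄ w∈M w∉π)
      where
      open PlaneOf πQ using () renaming (lines⊑plane to Q-lines⊑; X⊑plane to Q⊑Q-plane)
      w∈M : w ∈⟨ m₅ ◁ m₄ ◁ plane ⟩
      w∈M = ∈-⊑ M⊑m₅m₄plane (∈-⊑ (MPoint-lines⊑M M Q Q-M Q∈j) w∈j)
      QP⊑π : (basis Q zero ◁ Pb) ⊑ plane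
      QP⊑π = ◁-⊑ Q∈π X⊑plane
      T-indep : LinIndep (w ◁ basis Q zero ◁ Pb)
      T-indep = LinIndep-◁ (LinIndep-◁ (independent P) (≭⇒∉ {P} {Q} P≭Q)) (w∉π ∘ ∈-⊑ QP⊑π)
      Q-plane⊑T : PlaneOf.plane πQ ⊑ (w ◁ basis Q zero ◁ Pb)
      Q-plane⊑T = LinIndep-⊑⇒⊒ T-indep
        (◁-⊑ (∈-⊑ (Q-lines⊑ Q∈j) w∈j) (◁-⊑ (at Q⊑Q-plane zero) (⊑-trans P∈i (Q-lines⊑ Q∈i))))
      from-pencil : (∃ λ c → w ∈⟨ solid c ⟩ × pointOn m₅ m₄ c ∈⟨ w ◁ plane ⟩) → SolidOf Q
      from-pencil (c , w∈solid , _) = record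
        { class = c
        ; solid-indep = LinIndep-◁ plane-indep λ z∈π → w∉π (∈-⊑ (◁-⊑ z∈π (⊑-refl plane)) w∈solid)
        ; lines⊑solid = λ Q∈k → ⊑-trans (Q-lines⊑ Q∈k) (⊑-trans Q-plane⊑T (◁-⊑ w∈solid (⊑-◁ _ QP⊑π)))
        }

    solid-of : ∀ {Q} → IsMPoint q L M Q → basis Q zero ∈⟨ plane ⟩ → ¬ P ≐ Q → SolidOf Q
    solid-of {Q} Q-M Q∈π P≭Q = from-lines (PQ-line {Q} Q∈π P≭Q) (Q-leaves-plane {Q} Q-M P≭Q)
      where
      from-lines : (∃ λ i → through P i × through Q i) → (∃ λ j → through Q j × ¬ within plane j) → SolidOf Q
      from-lines (i , P∈i , Q∈i) (j , Q∈j , j⋢π) =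
        solid-from-lines Q-M (MPoint-plane M Q Q-M) Q∈π P≭Q P∈i Q∈i Q∈j (generator-∈ (line j) _) (proj₂ (⋢⇒∃∉ j⋢π))

    distinct-classes : ∀ {Q R} (Q-M : IsMPoint q L M Q) (R-M : IsMPoint q L M R) (SQ : SolidOf Q) (SR : SolidOf R) →
                       ¬ P ≐ Q → ¬ P ≐ R → ¬ Q ≐ R → class SQ ≢ class SR
    distinct-classes {Q} {R} Q-M R-M SQ SR P≭Q P≭R Q≭R same =
      no-three-large-within (through? P) (through? Q) (within? (solid (class SQ))) (through? R) 2≤q
        (λ P∈i → ⊑-trans (lines⊑plane P∈i) (⊑-◁ _ (⊑-refl plane))) (lines⊑solid SQ)
        (λ R∈i → ≡.subst (λ c → within (solid c) _) (≡.sym same) (lines⊑solid SR R∈i))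
        (MPoint-count M P P-M) (MPoint-count M Q Q-M) (MPoint-count M R R-M) (solid-≤ (solid-indep SQ))
        (through-two-points-≤1 {P} {Q} P≭Q) (through-two-points-≤1 {P} {R} P≭R) (through-two-points-≤1 {Q} {R} Q≭R)

    at-most-q+2 : (Qs : List Point) → PointSet Qs → All (λ Q → InPiP L P Q × IsMPoint q L M Q) Qs → length Qs ≤ q + 2
    at-most-q+2 Qs Qs-set Qs-in = ≡.subst (length Qs ≤_) (ℕP.+-comm 2 q) (FinP.injective⇒≤ code-injective)
      where
      Q : Fin (length Qs) → Point
      Q = lookup Qs
      Q-M : ∀ k → IsMPoint q L M (Q k)
      Q-M k = proj₂ (All.lookup Qs-in (∈-lookup k))
      solid-of-Q : ∀ k → ¬ P ≐ Q k → SolidOf (Q k)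
      solid-of-Q k P≭Q = solid-of {Q k} (Q-M k) (InPiP⇒∈ {Q k} (proj₁ (All.lookup Qs-in (∈-lookup k)))) P≭Q
      distinct : ∀ {k k′} → k ≢ k′ → ¬ Q k ≐ Q k′
      distinct k≢k′ with AllPairs-lookup Qs-set k≢k′
      ... | inj₁ Q≭Q′ = Q≭Q′
      ... | inj₂ Q′≭Q = Q′≭Q ∘ ≐-sym {X = Q _} {Q _}
      code : ∀ k → Dec (P ≐ Q k) → Fin (suc (suc q))
      code k (yes _) = zero
      code k (no P≭Q) = suc (class (solid-of-Q k P≭Q))
      code-injective′ : ∀ {k k′} d d′ → code k d ≡ code k′ d′ → k ≡ k′
      code-injective′ {k} {k′} (yes P≐Q) (yes P≐Q′) _ =
        decidable-stable (k FinP.≟ k′) λ k≢k′ → distinct k≢k′ (≐-trans {Q k} {P} {Q k′} (≐-sym {X = P} {Q k} P≐Q) P≐Q′)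
      code-injective′ (yes _) (no _) ()
      code-injective′ (no _) (yes _) ()
      code-injective′ {k} {k′} (no P≭Q) (no P≭Q′) e =
        decidable-stable (k FinP.≟ k′) λ k≢k′ →
          distinct-classes (Q-M k) (Q-M k′) (solid-of-Q k P≭Q) (solid-of-Q k′ P≭Q′) P≭Q P≭Q′ (distinct k≢k′)
            (FinP.suc-injective e)
      code-injective : ∀ {k k′} → code k (P ≐? Q k) ≡ code k′ (P ≐? Q k′) → k ≡ k′
      code-injective = code-injective′ _ _

open Nat using (_+_; _*_; _^_)

lemma8 : ∀ {c ℓ : Level} (F : Field c ℓ) (q n : ℕ) → HasOrder F q →
         (L : List (PG.Line F n)) → PG.LineSet F n L →
         (∀ (P : PG.Point F n) → ∃ λ k → PG.NumLinesThrough F n L P k × (k ≡ 0 ⊎ k ≡ q + 1)) →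
         (∀ (π : PG.Plane F n) → ∃ λ k → PG.NumLinesIn F n L π k × (k ≡ 0 ⊎ k ≡ 1 ⊎ k ≡ q + 1)) →
         (∀ (S : PG.Solid F n) → ∃ λ k → PG.NumLinesIn F n L S k
            × (k ≡ 0 ⊎ k ≡ 1 ⊎ k ≡ q + 1 ⊎ k ≡ 2 * q + 1)) →
         length L ≤ q ^ 5 + q ^ 4 + q ^ 3 + q ^ 2 + q + 1 →
         (M : PG.Sub F n 4) → (P : PG.Point F n) → PG.IsMPoint F n q L M P →
         (Qs : List (PG.Point F n)) → PG.PointSet F n Qs →
         All (λ Q → PG.InPiP F n L P Q × PG.IsMPoint F n q L M Q) Qs →
         length Qs ≤ q + 2
lemma8 F q n F-order L L-set Pt Pl Sd _ M P P-M Qs Qs-set Qs-in =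
  through-extension (PlaneOfMPoint.∃-extension-to-M M P P-M πP)
  where
  open PG F n using (basis)
  open LinearAlgebra F F-order n using (_⊑_)
  open Configuration F F-order n L L-set Pt Pl Sd
  πP = MPoint-plane M P P-M
  through-extension : (∃₂ λ m₅ m₄ → basis M ⊑ (m₅ ◁ m₄ ◁ PlaneOf.plane πP)) → length Qs ≤ q + 2
  through-extension (m₅ , m₄ , M⊑m₅m₄πP) = SolidsThroughPlane.at-most-q+2 M P P-M πP m₅ m₄ M⊑m₅m₄πP Qs Qs-set Qs-in
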